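{- Let $m\ge2$ and let $S\subseteq\mathfrak{S}_{m+1}$ be such that each permutation $\tau\in S$ is indecomposable. Then the graph $G_S$ is strongly connected.
   Context: A permutation $\pi\in\mathfrak{S}_n$ is decomposable if there is $i$ with $1\le i\le n-1$ such that $\pi(1),\dots,\pi(i)\le i$; otherwise it is indecomposable. For $x$ with distinct coordinates, $\Pi(x)$ is the permutation with $\pi_i<\pi_j$ if and only if $x_i<x_j$. $G_S$ is the directed graph with vertex set $\mathfrak{S}_m$ and an edge from $\pi$ to $\sigma$ if some $\tau\in\mathfrak{S}_{m+1}\setminus S$ has $\Pi(\tau_1,\dots,\tau_m)=\pi$ and $\Pi(\tau_2,\dots,\tau_{m+1})=\sigma$. -}

module Defs where

open import Data.Nat using (ℕ; suc)
open import Data.Fin using (Fin; toℕ; inject₁) renaming (_<_ to _<ᶠ_)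
import Data.Fin as F
open import Data.Fin.Permutation using (Permutation′; _⟨$⟩ʳ_)
open import Data.Product using (Σ; ∃; _×_)
open import Function.Bundles using (_⇔_)
open import Relation.Nullary using (¬_)
open import Relation.Unary using (Pred)
open import Level using (0ℓ)
open import Relation.Binary.Construct.Closure.ReflexiveTransitive using (Star)

-- Permutations of {1..n} are permutations of Fin n (0-based); π(k) is π ⟨$⟩ʳ k.

-- π is decomposable if there is i with 1 ≤ i ≤ n-1 such that π(1),…,π(i) ≤ i.
-- 0-based: positions k with toℕ k < i have values with toℕ value < i.
Decomposable : {n : ℕ} → Permutation′ n → Set
Decomposable {n} π =
  Σ ℕ λ i → (1 Data.Nat.≤ i) × (suc i Data.Nat.≤ n) ×
    ((k : Fin n) → toℕ k Data.Nat.< i → toℕ (π ⟨$⟩ʳ k) Data.Nat.< i)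

Indecomposable : {n : ℕ} → Permutation′ n → Set
Indecomposable π = ¬ Decomposable π

HasPattern : {m k : ℕ} → (Fin m → Fin k) → Permutation′ m → Set
HasPattern {m} x π =
  (i j : Fin m) → ((π ⟨$⟩ʳ i) <ᶠ (π ⟨$⟩ʳ j)) ⇔ (x i <ᶠ x j)

Edge : (m : ℕ) → Pred (Permutation′ (suc m)) 0ℓ →
       Permutation′ m → Permutation′ m → Set
Edge m S π σ =
  Σ (Permutation′ (suc m)) λ τ →
    ¬ S τ ×
    HasPattern (λ i → τ ⟨$⟩ʳ inject₁ i) π ×
    HasPattern (λ i → τ ⟨$⟩ʳ F.suc i) σ

StronglyConnected : (m : ℕ) → Pred (Permutation′ (suc m)) 0ℓ → Set
StronglyConnected m S = (π σ : Permutation′ m) → Star (Edge m S) π σ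

-- Every vertex reaches the identity, and the identity reaches every vertex,
-- along edges given by decomposable τ, which never lie in S.  The edge given by
-- τ = π ⊕ 1 leads from π to the pattern of π(2),…,π(m),m+1, which fixes one more
-- final position than π does; after m such edges every position is fixed.
-- Dually, the edge given by τ = 1 ⊕ σ leads into σ from the pattern of
-- 0,σ(1),…,σ(m-1), which fixes one more initial position than σ does.
module Submission where

open import Defs
open import Data.Nat using (ℕ; suc; zero; z≤n; s≤s; _≤_; _<_; _≤‴_; ≤‴-refl; ≤‴-step)
open import Relation.Unary using (Pred)
open import Level using (0ℓ)
open import Data.Nat.Properties
  using (≤-refl; <⇒≤; <⇒≱; ≤⇒≯; <-irrefl; <-≤-trans; ≰⇒>; ≮⇒≥; suc-injective; m≤n⇒m≤1+n; ≤‴⇒≤; 0≤‴n)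
open import Data.Fin using (Fin; toℕ; inject₁; fromℕ; punchIn; punchOut) renaming (_<_ to _<ᶠ_)
import Data.Fin as F
open import Data.Fin.Properties
  using (toℕ-injective; toℕ-inject₁; toℕ-fromℕ; toℕ<n; ≤∧≢⇒<; <⇒≢;
         punchOut-cong; punchOut-injective; punchOut-mono-≤; punchOut-cancel-≤; _≟_)
open import Data.Fin.Relation.Unary.Top using (view; ‵fromℕ; ‵inject₁)
open import Data.Fin.Permutation
  using (Permutation′; _⟨$⟩ʳ_; _≈_; id; remove; insert; lift₀; insert-punchIn; remove-insert)
open import Data.Product using (_,_)
open import Function.Bundles using (_⇔_; mk⇔; Equivalence; Injection)
open import Function.Properties.Inverse using (↔⇒↣)
open import Relation.Nullary using (¬_; yes; no; contradiction)
open import Relation.Binary.PropositionalEquality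
  using (_≡_; _≢_; refl; sym; trans; cong; subst; subst₂; module ≡-Reasoning)
open import Relation.Binary.Construct.Closure.ReflexiveTransitive using (Star; ε; _◅_; _◅◅_)

private
  variable
    n : ℕ

HasPattern-resp : ∀ {k} {x y : Fin n → Fin k} {π ρ : Permutation′ n} →
                  π ≈ ρ → (∀ i → x i ≡ y i) → HasPattern x π → HasPattern y ρ
HasPattern-resp π≈ρ x≗y pat a b = mk⇔
  (λ r → subst₂ _<ᶠ_ (x≗y a) (x≗y b)
           (Equivalence.to (pat a b) (subst₂ _<ᶠ_ (sym (π≈ρ a)) (sym (π≈ρ b)) r)))
  (λ r → subst₂ _<ᶠ_ (π≈ρ a) (π≈ρ b)
           (Equivalence.from (pat a b) (subst₂ _<ᶠ_ (sym (x≗y a)) (sym (x≗y b)) r)))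

punchOut-<⇔ : ∀ {i j k : Fin (suc n)} (i≢j : i ≢ j) (i≢k : i ≢ k) →
              (punchOut i≢j <ᶠ punchOut i≢k) ⇔ (j <ᶠ k)
punchOut-<⇔ {i = i} i≢j i≢k = mk⇔
  (λ r → ≤∧≢⇒< (punchOut-cancel-≤ i≢j i≢k (<⇒≤ r)) (λ j≡k → <⇒≢ r (punchOut-cong i j≡k)))
  (λ r → ≤∧≢⇒< (punchOut-mono-≤ i≢j i≢k (<⇒≤ r)) (λ p≡p → <⇒≢ r (punchOut-injective i≢j i≢k p≡p)))

toℕ-punchOut-below : ∀ {i j : Fin (suc n)} (i≢j : i ≢ j) →
                     toℕ j < toℕ i → toℕ (punchOut i≢j) ≡ toℕ j
toℕ-punchOut-below {i = F.zero}                  _   ()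
toℕ-punchOut-below {suc n} {F.suc i} {F.zero}  _   _         = refl
toℕ-punchOut-below {suc n} {F.suc i} {F.suc j} i≢j (s≤s j<i) =
  cong suc (toℕ-punchOut-below (λ i≡j → i≢j (cong F.suc i≡j)) j<i)

toℕ-punchOut-above : ∀ {i j : Fin (suc n)} (i≢j : i ≢ j) →
                     toℕ i < toℕ j → suc (toℕ (punchOut i≢j)) ≡ toℕ j
toℕ-punchOut-above {i = F.zero} {F.zero}  i≢j _         = contradiction refl i≢j
toℕ-punchOut-above {i = F.zero} {F.suc j} _   _         = refl
toℕ-punchOut-above {suc n} {F.suc i} {F.suc j} i≢j (s≤s i<j) =
  cong suc (toℕ-punchOut-above (λ i≡j → i≢j (cong F.suc i≡j)) i<j)

punchIn-fromℕ : (i : Fin n) → punchIn (fromℕ n) i ≡ inject₁ i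
punchIn-fromℕ F.zero    = refl
punchIn-fromℕ (F.suc i) = cong F.suc (punchIn-fromℕ i)

remove-hasPattern : (i : Fin (suc n)) (τ : Permutation′ (suc n)) →
                    HasPattern (λ j → τ ⟨$⟩ʳ punchIn i j) (remove i τ)
remove-hasPattern i τ a b =
  punchOut-<⇔ {i = τ ⟨$⟩ʳ i} {τ ⟨$⟩ʳ punchIn i a} {τ ⟨$⟩ʳ punchIn i b} _ _

module _ {m : ℕ} {S : Pred (Permutation′ (suc m)) 0ℓ}
         (indecomposable : (τ : Permutation′ (suc m)) → S τ → Indecomposable τ) where

  decomposable⇒edge : ∀ (τ : Permutation′ (suc m)) π σ → Decomposable τ →
                      remove (fromℕ m) τ ≈ π → remove F.zero τ ≈ σ → Edge m S π σ
  decomposable⇒edge τ π σ dec π≈ σ≈ =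
    τ , (λ τ∈S → indecomposable τ τ∈S dec) ,
    HasPattern-resp {π = remove (fromℕ m) τ} {ρ = π} π≈
      (λ i → cong (τ ⟨$⟩ʳ_) (punchIn-fromℕ i)) (remove-hasPattern (fromℕ m) τ) ,
    HasPattern-resp {π = remove F.zero τ} {ρ = σ} σ≈ (λ _ → refl) (remove-hasPattern F.zero τ)

Fixes : Permutation′ n → Pred (Fin n) 0ℓ → Set
Fixes π P = ∀ j → P j → π ⟨$⟩ʳ j ≡ j

FixesFrom : ℕ → Permutation′ n → Set
FixesFrom t π = Fixes π (λ j → t ≤ toℕ j)

FixesBelow : ℕ → Permutation′ n → Set
FixesBelow t π = Fixes π (λ j → toℕ j < t)

fixes-complement : ∀ (π : Permutation′ n) {P : Pred (Fin n) 0ℓ} →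
                   Fixes π P → ∀ j → ¬ P j → ¬ P (π ⟨$⟩ʳ j)
fixes-complement π {P} fix j ¬Pj Pπj =
  ¬Pj (subst P (Injection.injective (↔⇒↣ π) (fix (π ⟨$⟩ʳ j) Pπj)) Pπj)

fixesFrom-size : (π : Permutation′ n) → FixesFrom n π
fixesFrom-size π j n≤j = contradiction (<-≤-trans (toℕ<n j) n≤j) (<-irrefl refl)

fixesFrom⇒decomposable : ∀ {i} (τ : Permutation′ n) →
                         1 ≤ i → i < n → FixesFrom i τ → Decomposable τ
fixesFrom⇒decomposable {i = i} τ 1≤i i<n fix =
  i , 1≤i , i<n , λ k k<i → ≰⇒> (fixes-complement τ fix k (<⇒≱ k<i))

fixesBelow⇒decomposable : ∀ {i} (τ : Permutation′ n) →
                          1 ≤ i → i < n → FixesBelow i τ → Decomposable τ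
fixesBelow⇒decomposable {i = i} τ 1≤i i<n fix =
  i , 1≤i , i<n , λ k k<i → subst (λ x → toℕ x < i) (sym (fix k k<i)) k<i

remove-zero-fixesFrom : ∀ {t} (τ : Permutation′ (suc n)) →
                        FixesFrom (suc t) τ → FixesFrom t (remove F.zero τ)
remove-zero-fixesFrom {t = t} τ fix j t≤j = toℕ-injective (suc-injective (begin
  suc (toℕ (remove F.zero τ ⟨$⟩ʳ j)) ≡⟨ toℕ-punchOut-above _ τ₀<τⱼ₊₁ ⟩
  toℕ (τ ⟨$⟩ʳ F.suc j)               ≡⟨ cong toℕ τⱼ₊₁≡j+1 ⟩
  suc (toℕ j)                         ∎))
  where
  open ≡-Reasoning
  τⱼ₊₁≡j+1 : τ ⟨$⟩ʳ F.suc j ≡ F.suc j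
  τⱼ₊₁≡j+1 = fix (F.suc j) (s≤s t≤j)
  τ₀<t+1 : toℕ (τ ⟨$⟩ʳ F.zero) < suc t
  τ₀<t+1 = ≰⇒> (fixes-complement τ fix F.zero λ ())
  τ₀<τⱼ₊₁ : toℕ (τ ⟨$⟩ʳ F.zero) < toℕ (τ ⟨$⟩ʳ F.suc j)
  τ₀<τⱼ₊₁ = subst (λ x → toℕ (τ ⟨$⟩ʳ F.zero) < toℕ x) (sym τⱼ₊₁≡j+1)
              (<-≤-trans τ₀<t+1 (s≤s t≤j))

remove-last-fixesBelow : ∀ {t} (τ : Permutation′ (suc n)) → t ≤ n →
                         FixesBelow t τ → FixesBelow t (remove (fromℕ n) τ)
remove-last-fixesBelow {n} {t} τ t≤n fix j j<t = toℕ-injective (begin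
  toℕ (remove (fromℕ n) τ ⟨$⟩ʳ j) ≡⟨ toℕ-punchOut-below _ τⱼ<τₙ ⟩
  toℕ (τ ⟨$⟩ʳ punchIn (fromℕ n) j) ≡⟨ toℕ-τⱼ ⟩
  toℕ j                             ∎)
  where
  open ≡-Reasoning
  toℕ-τⱼ : toℕ (τ ⟨$⟩ʳ punchIn (fromℕ n) j) ≡ toℕ j
  toℕ-τⱼ = begin
    toℕ (τ ⟨$⟩ʳ punchIn (fromℕ n) j) ≡⟨ cong (λ x → toℕ (τ ⟨$⟩ʳ x)) (punchIn-fromℕ j) ⟩
    toℕ (τ ⟨$⟩ʳ inject₁ j)           ≡⟨ cong toℕ (fix (inject₁ j) (subst (_< t) (sym (toℕ-inject₁ j)) j<t)) ⟩
    toℕ (inject₁ j)                   ≡⟨ toℕ-inject₁ j ⟩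
    toℕ j                             ∎
  t≤τₙ : t ≤ toℕ (τ ⟨$⟩ʳ fromℕ n)
  t≤τₙ = ≮⇒≥ (fixes-complement τ fix (fromℕ n)
                (subst (λ k → ¬ k < t) (sym (toℕ-fromℕ n)) (≤⇒≯ t≤n)))
  τⱼ<τₙ : toℕ (τ ⟨$⟩ʳ punchIn (fromℕ n) j) < toℕ (τ ⟨$⟩ʳ fromℕ n)
  τⱼ<τₙ = subst (_< toℕ (τ ⟨$⟩ʳ fromℕ n)) (sym toℕ-τⱼ) (<-≤-trans j<t t≤τₙ)

_⊕1 : Permutation′ n → Permutation′ (suc n)
_⊕1 {n} π = insert (fromℕ n) (fromℕ n) π

⊕1-fromℕ : (π : Permutation′ n) → (π ⊕1) ⟨$⟩ʳ fromℕ n ≡ fromℕ n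
⊕1-fromℕ {n} π with fromℕ n ≟ fromℕ n
... | yes _   = refl
... | no  ≢fn = contradiction refl ≢fn

⊕1-inject₁ : (π : Permutation′ n) (i : Fin n) → (π ⊕1) ⟨$⟩ʳ inject₁ i ≡ inject₁ (π ⟨$⟩ʳ i)
⊕1-inject₁ {n} π i = begin
  (π ⊕1) ⟨$⟩ʳ inject₁ i            ≡⟨ cong ((π ⊕1) ⟨$⟩ʳ_) (sym (punchIn-fromℕ i)) ⟩
  (π ⊕1) ⟨$⟩ʳ punchIn (fromℕ n) i  ≡⟨ insert-punchIn (fromℕ n) (fromℕ n) π i ⟩
  punchIn (fromℕ n) (π ⟨$⟩ʳ i)      ≡⟨ punchIn-fromℕ (π ⟨$⟩ʳ i) ⟩
  inject₁ (π ⟨$⟩ʳ i)                ∎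
  where open ≡-Reasoning

⊕1-fixesFrom : ∀ {t} (π : Permutation′ n) → FixesFrom t π → FixesFrom t (π ⊕1)
⊕1-fixesFrom π fix j t≤j with view j
... | ‵fromℕ     = ⊕1-fromℕ π
... | ‵inject₁ i = trans (⊕1-inject₁ π i)
                     (cong inject₁ (fix i (subst (_ ≤_) (toℕ-inject₁ i) t≤j)))

lift₀-fixesBelow : ∀ {t} (σ : Permutation′ n) → FixesBelow t σ → FixesBelow (suc t) (lift₀ σ)
lift₀-fixesBelow σ fix F.zero    _         = refl
lift₀-fixesBelow σ fix (F.suc j) (s≤s j<t) = cong F.suc (fix j j<t)

successor : Permutation′ n → Permutation′ n
successor π = remove F.zero (π ⊕1)

predecessor : Permutation′ n → Permutation′ n
predecessor {n} σ = remove (fromℕ n) (lift₀ σ)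

successor-fixesFrom : ∀ {t} (π : Permutation′ n) → FixesFrom (suc t) π → FixesFrom t (successor π)
successor-fixesFrom π fix = remove-zero-fixesFrom (π ⊕1) (⊕1-fixesFrom π fix)

predecessor-fixesBelow : ∀ {t} (σ : Permutation′ n) → t < n →
                         FixesBelow t σ → FixesBelow (suc t) (predecessor σ)
predecessor-fixesBelow σ t<n fix = remove-last-fixesBelow (lift₀ σ) t<n (lift₀-fixesBelow σ fix)

module _ {n : ℕ} {S : Pred (Permutation′ (suc (suc n))) 0ℓ}
         (indecomposable : (τ : Permutation′ (suc (suc n))) → S τ → Indecomposable τ) where

  ⊕1-edge : ∀ π σ → successor π ≈ σ → Edge (suc n) S π σ
  ⊕1-edge π σ =
    decomposable⇒edge indecomposable (π ⊕1) π σ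
      (fixesFrom⇒decomposable (π ⊕1) (s≤s z≤n) ≤-refl (⊕1-fixesFrom π (fixesFrom-size π)))
      (remove-insert (fromℕ (suc n)) (fromℕ (suc n)) π)

  lift₀-edge : ∀ π σ → predecessor σ ≈ π → Edge (suc n) S π σ
  lift₀-edge π σ π≈ =
    decomposable⇒edge indecomposable (lift₀ σ) π σ
      (fixesBelow⇒decomposable (lift₀ σ) ≤-refl (s≤s (s≤s z≤n)) (lift₀-fixesBelow σ (λ _ ())))
      π≈ (λ _ → refl)

  path-to-id : ∀ t π → FixesFrom (suc t) π → Star (Edge (suc n) S) π id
  path-to-id zero    π fix = ⊕1-edge π id (λ j → successor-fixesFrom π fix j z≤n) ◅ ε
  path-to-id (suc t) π fix =
    ⊕1-edge π (successor π) (λ _ → refl) ◅ path-to-id t (successor π) (successor-fixesFrom π fix)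

  path-from-id : ∀ {t} → t ≤‴ n → ∀ σ → FixesBelow t σ → Star (Edge (suc n) S) id σ
  path-from-id ≤‴-refl σ fix =
    lift₀-edge id σ (λ j → predecessor-fixesBelow σ ≤-refl fix j (toℕ<n j)) ◅ ε
  path-from-id (≤‴-step t<n) σ fix =
    path-from-id t<n (predecessor σ) (predecessor-fixesBelow σ (m≤n⇒m≤1+n (≤‴⇒≤ t<n)) fix)
    ◅◅ lift₀-edge (predecessor σ) σ (λ _ → refl) ◅ ε

proposition3p8 : (m : ℕ) → 2 ≤ m → (S : Pred (Permutation′ (suc m)) 0ℓ) →
                 ((τ : Permutation′ (suc m)) → S τ → Indecomposable τ) →
                 StronglyConnected m S
proposition3p8 zero    ()
proposition3p8 (suc n) _  S indecomposable π σ =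
  path-to-id indecomposable n π (fixesFrom-size π)
  ◅◅ path-from-id indecomposable 0≤‴n σ (λ _ ())
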